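{- For every positive integer $n$, $PF(n,n)=\left\lceil \frac{n}{2}\right\rceil$.
   Context: A partition $\lambda=(\lambda_1\ge\cdots\ge\lambda_\ell)$ of $n$ is a finite nonincreasing sequence of positive integers with sum $n$; $\ell(\lambda)$ is its number of parts. The hook length $h_{(i,j)}(\lambda)$ of a cell $(i,j)$ of the Ferrers diagram is the number of cells consisting of the cell itself, the cells to its right in its row and the cells below it in its column. A numerical set is a subset $S\subseteq\mathbb{N}_0$ containing $0$ with finite complement; a numerical semigroup is a numerical set closed under addition. For a partition $\lambda$ let $S_\lambda=\mathbb{N}_0\setminus\{h_{(i,1)}(\lambda):1\le i\le\ell(\lambda)\}$; its Frobenius number (largest element of the complement) equals the largest hook length $h_{(1,1)}(\lambda)$. $PF(n,f)$ is the number of partitions $\lambda$ of $n$ with largest hook length $h_{(1,1)}(\lambda)=f$ such that $S_\lambda$ is a numerical semigroup. -}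

module Defs where

open import Data.Nat using (ℕ; zero; suc; _+_; _∸_; _≤_; _<_; _≥_; _≤?_)
open import Data.List using (List; []; _∷_; length; filter; map; upTo)
open import Data.Nat.ListAction using (sum)
open import Data.List.Relation.Unary.All using (All)
open import Data.List.Relation.Unary.Linked using (Linked)
open import Data.List.Relation.Unary.Unique.Propositional using (Unique)
open import Data.List.Membership.Propositional using (_∈_; _∉_)
open import Data.Product using (Σ; _×_)
open import Function.Bundles using (_⇔_)
open import Relation.Binary.PropositionalEquality using (_≡_)

Partition : Set
Partition = List ℕ

IsPartitionOf : ℕ → Partition → Set
IsPartitionOf n la = Linked _≥_ la × All (λ x → 0 < x) la × sum la ≡ n

ℓ : Partition → ℕ
ℓ = length

-- λ_i, 1-indexed (0 outside 1 ≤ i ≤ ℓ(λ))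
part : Partition → ℕ → ℕ
part []       _             = 0
part (x ∷ xs) zero          = 0
part (x ∷ xs) (suc zero)    = x
part (x ∷ xs) (suc (suc i)) = part xs (suc i)

colLength : Partition → ℕ → ℕ
colLength la j = length (filter (λ x → j ≤? x) la)

-- hook length of cell (i , j) (1-indexed):
-- arm (λ_i - j) + leg (λ'_j - i) + the cell itself
hook : Partition → ℕ → ℕ → ℕ
hook la i j = (part la i ∸ j) + (colLength la j ∸ i) + 1

firstColumnHooks : Partition → List ℕ
firstColumnHooks la = map (λ i → hook la (suc i) 1) (upTo (ℓ la))

S : Partition → ℕ → Set
S la m = m ∉ firstColumnHooks la

-- a numerical set (containing 0; complement is finite by construction,
-- being a finite list) that is closed under addition
IsNumericalSemigroup : (ℕ → Set) → Set
IsNumericalSemigroup T = T 0 × (∀ a b → T a → T b → T (a + b))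

PFProp : ℕ → ℕ → Partition → Set
PFProp n f la = IsPartitionOf n la × hook la 1 1 ≡ f × IsNumericalSemigroup (S la)

-- "exactly k objects satisfy P": some duplicate-free list enumerates P and has length k
HasCount : (Partition → Set) → ℕ → Set
HasCount P k = Σ (List Partition) (λ L → Unique L × (∀ μ → (μ ∈ L) ⇔ P μ) × length L ≡ k)

PFis : ℕ → ℕ → ℕ → Set
PFis n f k = HasCount (PFProp n f) k

{-# OPTIONS --safe #-}
module Submission where

-- Since h₁₁(λ) = λ₁ + ℓ(λ) − 1 ≤ |λ|, with equality exactly when all parts
-- but the first equal 1, the partitions of n with h₁₁ = n are the hooks
-- (j+1, 1ᵏ) with j + k = n − 1.  Their first-column hooks are {1, …, k, n},
-- so S_λ = {0} ∪ {k+1, k+2, …} ∖ {n}.  If j ≤ k this is closed under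
-- addition (two nonzero elements sum to at least 2k+2 > n); if j > k then
-- k+1 and j lie in S_λ but sum to n.  Hence j ranges over 0, …, ⌊(n−1)/2⌋.

open import Defs
open import Data.Nat using (ℕ; zero; suc; _+_; _∸_; _≤_; _<_; _≥_; _≤?_; z≤n; s≤s; z<s; ⌊_/2⌋; ⌈_/2⌉)
open import Data.Nat.Properties
open import Data.Nat.ListAction using (sum)
open import Data.List using (List; []; _∷_; length; applyUpTo; replicate)
open import Data.List.Properties using (filter-all; length-replicate; length-applyUpTo; ∷-injectiveˡ)
open import Data.List.Relation.Unary.All using (All; []; _∷_)
open import Data.List.Relation.Unary.All.Properties using (replicate⁺)
open import Data.List.Relation.Unary.Linked using (Linked; []; [-]; _∷_)
open import Data.List.Membership.Propositional using (_∈_)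
open import Data.List.Membership.Propositional.Properties using (∈-map⁺; ∈-map⁻; ∈-upTo⁺; ∈-upTo⁻; ∈-applyUpTo⁺; ∈-applyUpTo⁻)
open import Data.List.Relation.Unary.Unique.Propositional using (Unique)
open import Data.List.Relation.Unary.Unique.Propositional.Properties using (applyUpTo⁺₁)
open import Data.Product using (_×_; _,_; ∃-syntax)
open import Data.Sum using (_⊎_; inj₁; inj₂)
open import Function.Bundles using (_⇔_; mk⇔; Equivalence)
open import Relation.Nullary using (yes; no; contradiction)
open import Relation.Binary.PropositionalEquality

open Equivalence using (to; from)

hookPartition : ℕ → ℕ → Partition
hookPartition j k = suc j ∷ replicate k 1

hookPartition-injectiveˡ : ∀ {j k j′ k′} → hookPartition j k ≡ hookPartition j′ k′ → j ≡ j′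
hookPartition-injectiveˡ eq = suc-injective (∷-injectiveˡ eq)

Linked-replicate : ∀ {A : Set} {R : A → A → Set} {x : A} → R x x → ∀ k → Linked R (replicate k x)
Linked-replicate r zero          = []
Linked-replicate r (suc zero)    = [-]
Linked-replicate r (suc (suc k)) = r ∷ Linked-replicate r (suc k)

sum-replicate-1 : ∀ k → sum (replicate k 1) ≡ k
sum-replicate-1 zero    = refl
sum-replicate-1 (suc k) = cong suc (sum-replicate-1 k)

hookPartition-positive : ∀ j k → All (0 <_) (hookPartition j k)
hookPartition-positive j k = z<s ∷ replicate⁺ k z<s

hookPartition-isPartitionOf : ∀ j k → IsPartitionOf (suc (j + k)) (hookPartition j k)
hookPartition-isPartitionOf j k = linked k , hookPartition-positive j k , cong (suc j +_) (sum-replicate-1 k)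
  where
  linked : ∀ k → Linked _≥_ (hookPartition j k)
  linked zero    = [-]
  linked (suc k) = s≤s z≤n ∷ Linked-replicate ≤-refl (suc k)

part-replicate-≤ : ∀ k x i → part (replicate k x) i ≤ x
part-replicate-≤ zero    x i             = z≤n
part-replicate-≤ (suc k) x zero          = z≤n
part-replicate-≤ (suc k) x (suc zero)    = ≤-refl
part-replicate-≤ (suc k) x (suc (suc i)) = part-replicate-≤ k x (suc i)

colLength-1 : ∀ {μ} → All (0 <_) μ → colLength μ 1 ≡ ℓ μ
colLength-1 positive = cong length (filter-all (1 ≤?_) positive)

colLength-1-hookPartition : ∀ j k → colLength (hookPartition j k) 1 ≡ suc k
colLength-1-hookPartition j k = trans (colLength-1 (hookPartition-positive j k)) (cong suc (length-replicate k))

hook-1-1-hookPartition : ∀ j k → hook (hookPartition j k) 1 1 ≡ suc (j + k)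
hook-1-1-hookPartition j k = begin
  j + (colLength (hookPartition j k) 1 ∸ 1) + 1 ≡⟨ cong (λ c → j + (c ∸ 1) + 1) (colLength-1-hookPartition j k) ⟩
  j + k + 1                                     ≡⟨ +-comm (j + k) 1 ⟩
  suc (j + k)                                   ∎
  where open ≡-Reasoning

-- Valid for every i, also below the last row, since part ≤ 1 there as well.
hook-suc-suc-1-hookPartition : ∀ j k i → hook (hookPartition j k) (suc (suc i)) 1 ≡ suc (k ∸ suc i)
hook-suc-suc-1-hookPartition j k i = begin
  (part (replicate k 1) (suc i) ∸ 1) + (colLength (hookPartition j k) 1 ∸ suc (suc i)) + 1
    ≡⟨ cong₂ (λ a c → a + (c ∸ suc (suc i)) + 1)
             (m≤n⇒m∸n≡0 (part-replicate-≤ k 1 (suc i))) (colLength-1-hookPartition j k) ⟩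
  (k ∸ suc i) + 1
    ≡⟨ +-comm (k ∸ suc i) 1 ⟩
  suc (k ∸ suc i)
    ∎
  where open ≡-Reasoning

∈-firstColumnHooks : ∀ {μ m} → m ∈ firstColumnHooks μ ⇔ (∃[ i ] i < ℓ μ × m ≡ hook μ (suc i) 1)
∈-firstColumnHooks {μ} = mk⇔ split join
  where
  row : ℕ → ℕ
  row i = hook μ (suc i) 1
  split : ∀ {m} → m ∈ firstColumnHooks μ → ∃[ i ] i < ℓ μ × m ≡ row i
  split m∈ with i , i∈ , refl ← ∈-map⁻ row m∈ = i , ∈-upTo⁻ i∈ , refl
  join : ∀ {m} → ∃[ i ] i < ℓ μ × m ≡ row i → m ∈ firstColumnHooks μ
  join (i , i<ℓ , refl) = ∈-map⁺ row (∈-upTo⁺ i<ℓ)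

∈-firstColumnHooks-hookPartition :
  ∀ {j k m} → m ∈ firstColumnHooks (hookPartition j k) ⇔ (m ≡ suc (j + k) ⊎ (0 < m × m ≤ k))
∈-firstColumnHooks-hookPartition {j} {k} = mk⇔ split join
  where
  ℓ≡ : ℓ (hookPartition j k) ≡ suc k
  ℓ≡ = cong suc (length-replicate k)
  split : ∀ {m} → m ∈ firstColumnHooks (hookPartition j k) → m ≡ suc (j + k) ⊎ (0 < m × m ≤ k)
  split m∈ with to ∈-firstColumnHooks m∈
  ... | zero , _ , refl = inj₁ (hook-1-1-hookPartition j k)
  ... | suc i , i<ℓ , refl rewrite hook-suc-suc-1-hookPartition j k i =
    inj₂ (z<s , ∸-monoʳ-< z<s (≤-pred (subst (suc (suc i) ≤_) ℓ≡ i<ℓ)))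
  join : ∀ {m} → m ≡ suc (j + k) ⊎ (0 < m × m ≤ k) → m ∈ firstColumnHooks (hookPartition j k)
  join (inj₁ refl) = from ∈-firstColumnHooks
    (0 , subst (0 <_) (sym ℓ≡) z<s , sym (hook-1-1-hookPartition j k))
  join {suc m} (inj₂ (_ , s≤s {n = k′} m≤k′)) = from ∈-firstColumnHooks
    ( suc (k′ ∸ m)
    , subst (suc (suc (k′ ∸ m)) ≤_) (sym ℓ≡) (s≤s (s≤s (m∸n≤m k′ m)))
    , sym (trans (hook-suc-suc-1-hookPartition j (suc k′) (k′ ∸ m)) (cong suc (m∸[m∸n]≡n m≤k′))))

S-hookPartition-large : ∀ {j k m} → 0 < m → S (hookPartition j k) m → k < m
S-hookPartition-large {k = k} {m} 0<m m∉ with m ≤? k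
... | yes m≤k = contradiction (from ∈-firstColumnHooks-hookPartition (inj₂ (0<m , m≤k))) m∉
... | no m≰k  = ≰⇒> m≰k

hookPartition-isNumericalSemigroup : ∀ {j k} → j ≤ k → IsNumericalSemigroup (S (hookPartition j k))
hookPartition-isNumericalSemigroup {j} {k} j≤k = 0∈S , closed
  where
  0∈S : S (hookPartition j k) 0
  0∈S 0∈ with to ∈-firstColumnHooks-hookPartition 0∈
  ... | inj₂ (() , _)
  closed : ∀ a b → S (hookPartition j k) a → S (hookPartition j k) b → S (hookPartition j k) (a + b)
  closed zero    b       _   b∈S = b∈S
  closed (suc a) zero    a∈S _   = subst (S (hookPartition j k)) (sym (+-identityʳ (suc a))) a∈S
  closed (suc a) (suc b) a∈S b∈S a+b∈ with to ∈-firstColumnHooks-hookPartition a+b∈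
  ... | inj₁ a+b≡n  = <⇒≢ n<a+b (sym a+b≡n)
    where
    n<a+b : suc (j + k) < suc a + suc b
    n<a+b = s≤s (subst (suc (j + k) ≤_) (sym (+-suc a b))
              (s≤s (+-mono-≤ (≤-trans j≤k (≤-pred (S-hookPartition-large z<s a∈S)))
                             (≤-pred (S-hookPartition-large z<s b∈S)))))
  ... | inj₂ (_ , a+b≤k) = <⇒≱ (≤-trans (S-hookPartition-large z<s a∈S) (m≤m+n (suc a) (suc b))) a+b≤k

hookPartition-isNumericalSemigroup⇒≤ : ∀ {j k} → IsNumericalSemigroup (S (hookPartition j k)) → j ≤ k
hookPartition-isNumericalSemigroup⇒≤ {j} {k} (_ , closed) with j ≤? k
... | yes j≤k = j≤k
... | no j≰k  = contradiction (from ∈-firstColumnHooks-hookPartition (inj₁ (cong suc (+-comm k j))))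
                             (closed (suc k) j 1+k∈S j∈S)
  where
  k<j : k < j
  k<j = ≰⇒> j≰k
  1+k∈S : S (hookPartition j k) (suc k)
  1+k∈S 1+k∈ with to ∈-firstColumnHooks-hookPartition 1+k∈
  ... | inj₁ eq          = <⇒≢ (s≤s (m<n+m k (≤-trans z<s k<j))) eq
  ... | inj₂ (_ , 1+k≤k) = 1+n≰n 1+k≤k
  j∈S : S (hookPartition j k) j
  j∈S j∈ with to ∈-firstColumnHooks-hookPartition j∈
  ... | inj₁ eq        = <⇒≢ (s≤s (m≤m+n j k)) eq
  ... | inj₂ (_ , j≤k) = <⇒≱ k<j j≤k

length≤sum : ∀ {μ} → All (0 <_) μ → length μ ≤ sum μ
length≤sum []       = z≤n
length≤sum (p ∷ ps) = +-mono-≤ p (length≤sum ps)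

sum≡length⇒replicate-1 : ∀ {μ} → All (0 <_) μ → sum μ ≡ length μ → μ ≡ replicate (length μ) 1
sum≡length⇒replicate-1 []                   _  = refl
sum≡length⇒replicate-1 {suc x ∷ μ} (_ ∷ ps) eq = cong₂ _∷_ (cong suc x≡0) (sum≡length⇒replicate-1 ps eq′)
  where
  x+sum≡length : x + sum μ ≡ length μ
  x+sum≡length = suc-injective eq
  x≡0 : x ≡ 0
  x≡0 = n≤0⇒n≡0 (+-cancelʳ-≤ (sum μ) x 0 (≤-trans (≤-reflexive x+sum≡length) (length≤sum ps)))
  eq′ : sum μ ≡ length μ
  eq′ = subst (λ y → y + sum μ ≡ length μ) x≡0 x+sum≡length

hook-1-1≡size⇒hookPartition :
  ∀ n μ → IsPartitionOf (suc n) μ → hook μ 1 1 ≡ suc n → ∃[ j ] ∃[ k ] j + k ≡ n × μ ≡ hookPartition j k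
hook-1-1≡size⇒hookPartition n []        (_ , _ , ())
hook-1-1≡size⇒hookPartition n (suc j ∷ μ) (_ , positive@(_ ∷ ps) , sum≡) h≡ =
  j , length μ , j+ℓ≡n , cong (suc j ∷_) (sum≡length⇒replicate-1 ps sum≡ℓ)
  where
  j+ℓ≡n : j + length μ ≡ n
  j+ℓ≡n = suc-injective (begin
    suc (j + length μ)                         ≡⟨ +-comm 1 (j + length μ) ⟩
    j + length μ + 1                           ≡⟨ cong (λ c → j + (c ∸ 1) + 1) (colLength-1 positive) ⟨
    j + (colLength (suc j ∷ μ) 1 ∸ 1) + 1      ≡⟨ h≡ ⟩
    suc n                                      ∎)
    where open ≡-Reasoning
  sum≡ℓ : sum μ ≡ length μ
  sum≡ℓ = +-cancelˡ-≡ j _ _ (trans (suc-injective sum≡) (sym j+ℓ≡n))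

m≤⌊n/2⌋⇒m+m≤n : ∀ {m} n → m ≤ ⌊ n /2⌋ → m + m ≤ n
m≤⌊n/2⌋⇒m+m≤n n m≤ = ≤-trans (+-mono-≤ m≤ (≤-trans m≤ (⌊n/2⌋≤⌈n/2⌉ n))) (≤-reflexive (⌊n/2⌋+⌈n/2⌉≡n n))

m+m≤n⇒m≤⌊n/2⌋ : ∀ {m n} → m + m ≤ n → m ≤ ⌊ n /2⌋
m+m≤n⇒m≤⌊n/2⌋ {m} m+m≤n = ≤-trans (≤-reflexive (n≡⌊n+n/2⌋ m)) (⌊n/2⌋-mono m+m≤n)

PFProp-diagonal⇔ :
  ∀ n μ → PFProp (suc n) (suc n) μ ⇔ (∃[ j ] j ≤ ⌊ n /2⌋ × μ ≡ hookPartition j (n ∸ j))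
PFProp-diagonal⇔ n μ = mk⇔ classify construct
  where
  classify : PFProp (suc n) (suc n) μ → ∃[ j ] j ≤ ⌊ n /2⌋ × μ ≡ hookPartition j (n ∸ j)
  classify (isPart , h≡ , semigroup) with hook-1-1≡size⇒hookPartition n μ isPart h≡
  ... | j , k , refl , refl =
    j , m+m≤n⇒m≤⌊n/2⌋ (+-monoʳ-≤ j (hookPartition-isNumericalSemigroup⇒≤ semigroup))
      , cong (hookPartition j) (sym (m+n∸m≡n j k))
  construct : ∃[ j ] j ≤ ⌊ n /2⌋ × μ ≡ hookPartition j (n ∸ j) → PFProp (suc n) (suc n) μ
  construct (j , j≤ , refl) =
    subst (λ t → PFProp (suc t) (suc t) (hookPartition j (n ∸ j))) j+k≡n
      (hookPartition-isPartitionOf j (n ∸ j) , hook-1-1-hookPartition j (n ∸ j)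
      , hookPartition-isNumericalSemigroup j≤k)
    where
    j+j≤n : j + j ≤ n
    j+j≤n = m≤⌊n/2⌋⇒m+m≤n n j≤
    j+k≡n : j + (n ∸ j) ≡ n
    j+k≡n = m+[n∸m]≡n (≤-trans (m≤m+n j j) j+j≤n)
    j≤k : j ≤ n ∸ j
    j≤k = +-cancelˡ-≤ j j (n ∸ j) (subst (j + j ≤_) (sym j+k≡n) j+j≤n)

theorem4p1 : (n : ℕ) → PFis (suc n) (suc n) ⌈ suc n /2⌉
theorem4p1 n = partitions , unique , (λ μ → mk⇔ (∈⇒PF μ) (PF⇒∈ μ)) , length-applyUpTo diagonal (suc ⌊ n /2⌋)
  where
  diagonal : ℕ → Partition
  diagonal j = hookPartition j (n ∸ j)
  partitions : List Partition
  partitions = applyUpTo diagonal (suc ⌊ n /2⌋)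
  unique : Unique partitions
  unique = applyUpTo⁺₁ diagonal (suc ⌊ n /2⌋) (λ i<j _ eq → <⇒≢ i<j (hookPartition-injectiveˡ eq))
  ∈⇒PF : ∀ μ → μ ∈ partitions → PFProp (suc n) (suc n) μ
  ∈⇒PF μ μ∈ with j , j<1+⌊n/2⌋ , μ≡ ← ∈-applyUpTo⁻ diagonal μ∈ =
    from (PFProp-diagonal⇔ n μ) (j , ≤-pred j<1+⌊n/2⌋ , μ≡)
  PF⇒∈ : ∀ μ → PFProp (suc n) (suc n) μ → μ ∈ partitions
  PF⇒∈ μ pf with j , j≤ , refl ← to (PFProp-diagonal⇔ n μ) pf = ∈-applyUpTo⁺ diagonal (s≤s j≤)
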